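{- Let $F,G:\mathbf{Sets}\to\mathbf{Sets}$ be functors, $\alpha:F\Rightarrow G$ a natural transformation all of whose components are surjective, and $\sqsubseteq_G$ an order on $G$. Let $b_1:X_1\to GX_1$, $b_2:X_2\to GX_2$ be $G$-coalgebras and $a_1:X_1\to FX_1$, $a_2:X_2\to FX_2$ any maps with $\alpha_{X_1}\circ a_1=b_1$ and $\alpha_{X_2}\circ a_2=b_2$. Then a relation $R\subseteq X_1\times X_2$ is a $\sqsubseteq_G$-simulation between $b_1$ and $b_2$ if and only if it is a $\sqsubseteq_G^{\alpha- }$-simulation between $a_1$ and $a_2$.
   Context: An order on a functor $F$ is a family of preorders $\sqsubseteq_X\subseteq FX\times FX$ such that for all $f:X\to Y$, $u\sqsubseteq_X u'$ implies $Ff(u)\sqsubseteq_Y Ff(u')$. For $R\subseteq X_1\times X_2$ with projections $r_1,r_2$, $R$ is a $\sqsubseteq$-simulation between coalgebras $c:X_1\to FX_1$, $d:X_2\to FX_2$ if for all $(x,y)\in R$ there is $w\in FR$ with $c(x)\sqsubseteq Fr_1(w)$ and $Fr_2(w)\sqsubseteq d(y)$. A natural transformation is a family $\alpha_X:FX\to GX$ with $Gf\circ\alpha_X=\alpha_Y\circ Ff$. The induced order $\sqsubseteq_G^{\alpha- }$ on $F$ is given by $u\sqsubseteq_G^{\alpha- }u'$ iff $\alpha_X(u)\sqsubseteq_G\alpha_X(u')$ for $u,u'\in FX$. -}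

module Defs where

open import Level using (Level; suc; _⊔_) renaming (zero to 0ℓ)
open import Data.Product using (Σ; ∃; _×_; _,_; proj₁; proj₂)
open import Relation.Binary.PropositionalEquality using (_≡_)
open import Relation.Binary.Structures using (IsPreorder)
open import Function using (_∘_; id)

record Functor : Set₁ where
  field
    F₀      : Set → Set
    F₁      : {X Y : Set} → (X → Y) → F₀ X → F₀ Y
    F-id    : {X : Set} (u : F₀ X) → F₁ (id {A = X}) u ≡ u
    F-comp  : {X Y Z : Set} (f : X → Y) (g : Y → Z) (u : F₀ X) →
              F₁ (g ∘ f) u ≡ F₁ g (F₁ f u)
open Functor public

record NatTrans (F G : Functor) : Set₁ where
  field
    η        : (X : Set) → F₀ F X → F₀ G X
    natural  : {X Y : Set} (f : X → Y) (u : F₀ F X) →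
               F₁ G f (η X u) ≡ η Y (F₁ F f u)
open NatTrans public

Surjective : {A B : Set} → (A → B) → Set
Surjective {A} f = ∀ b → Σ A (λ a → f a ≡ b)

record Order (F : Functor) : Set₁ where
  field
    _⊑_        : {X : Set} → F₀ F X → F₀ F X → Set
    isPreorder : (X : Set) → IsPreorder (_≡_ {A = F₀ F X}) (_⊑_ {X})
    monotone   : {X Y : Set} (f : X → Y) {u u' : F₀ F X} →
                 u ⊑ u' → F₁ F f u ⊑ F₁ F f u'
open Order public

Rel : Set → Set → Set₁
Rel X₁ X₂ = X₁ → X₂ → Set

Carrier : {X₁ X₂ : Set} → Rel X₁ X₂ → Set
Carrier {X₁} {X₂} R = Σ (X₁ × X₂) (λ p → R (proj₁ p) (proj₂ p))

r₁ : {X₁ X₂ : Set} (R : Rel X₁ X₂) → Carrier R → X₁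
r₁ R ((x , _) , _) = x

r₂ : {X₁ X₂ : Set} (R : Rel X₁ X₂) → Carrier R → X₂
r₂ R ((_ , y) , _) = y

IsSimulation : (F : Functor) (O : Order F) {X₁ X₂ : Set} →
               (X₁ → F₀ F X₁) → (X₂ → F₀ F X₂) → Rel X₁ X₂ → Set
IsSimulation F O {X₁} {X₂} c d R =
  ∀ (x : X₁) (y : X₂) → R x y →
    Σ (F₀ F (Carrier R)) λ w →
      _⊑_ O (c x) (F₁ F (r₁ R) w) × _⊑_ O (F₁ F (r₂ R) w) (d y)

inducedOrder : {F G : Functor} → NatTrans F G → Order G → Order F
inducedOrder {F} {G} α O = record
  { _⊑_ = λ {X} u u' → _⊑_ O (η α X u) (η α X u')
  ; isPreorder = λ X → record
      { isEquivalence = Relation.Binary.PropositionalEquality.isEquivalence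
      ; reflexive = λ { Relation.Binary.PropositionalEquality.refl →
                        IsPreorder.refl (isPreorder O X) }
      ; trans = IsPreorder.trans (isPreorder O X)
      }
  ; monotone = λ {X} {Y} f {u} {u'} le →
      Relation.Binary.PropositionalEquality.subst₂ (_⊑_ O)
        (natural α f u) (natural α f u') (monotone O f le)
  }

{-# OPTIONS --safe #-}
module Submission where

open import Defs
open import Data.Product using (_,_; map₂)
open import Relation.Binary.PropositionalEquality using (_≡_; refl; sym; subst₂)
open import Function using (_∘_; _⇔_; mk⇔)

-- Both directions rest on the naturality square F₁ G rᵢ ∘ η = η ∘ F₁ F rᵢ at the carrier of R:
-- a witness w ∈ F R for the induced order yields the witness η w ∈ G R, and conversely a
-- witness in G R is the image of one in F R as soon as η is surjective there.

module _ {G : Functor} (O : Order G) {X₁ X₂ : Set} where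

  IsSimulation-resp-≗ : {c c' : X₁ → F₀ G X₁} {d d' : X₂ → F₀ G X₂} →
                        (∀ x → c x ≡ c' x) → (∀ y → d y ≡ d' y) → (R : Rel X₁ X₂) →
                        IsSimulation G O c d R → IsSimulation G O c' d' R
  IsSimulation-resp-≗ c≗c' d≗d' R sim x y r =
    map₂ (λ { (l₁ , l₂) → subst₂ (_⊑_ O) (c≗c' x) refl l₁ , subst₂ (_⊑_ O) refl (d≗d' y) l₂ })
         (sim x y r)

module _ {F G : Functor} (α : NatTrans F G) (O : Order G) {X₁ X₂ : Set} where

  induced-simulation⇒simulation : (a₁ : X₁ → F₀ F X₁) (a₂ : X₂ → F₀ F X₂) (R : Rel X₁ X₂) →
    IsSimulation F (inducedOrder α O) a₁ a₂ R →
    IsSimulation G O (η α X₁ ∘ a₁) (η α X₂ ∘ a₂) R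
  induced-simulation⇒simulation a₁ a₂ R sim x y r with sim x y r
  ... | w , l₁ , l₂ =
    η α (Carrier R) w
      , subst₂ (_⊑_ O) refl (sym (natural α (r₁ R) w)) l₁
      , subst₂ (_⊑_ O) (sym (natural α (r₂ R) w)) refl l₂

  simulation⇒induced-simulation : (a₁ : X₁ → F₀ F X₁) (a₂ : X₂ → F₀ F X₂) (R : Rel X₁ X₂) →
    Surjective (η α (Carrier R)) →
    IsSimulation G O (η α X₁ ∘ a₁) (η α X₂ ∘ a₂) R →
    IsSimulation F (inducedOrder α O) a₁ a₂ R
  simulation⇒induced-simulation a₁ a₂ R surj sim x y r with sim x y r
  ... | w , l₁ , l₂ with surj w
  ... | w' , refl =
    w'
      , subst₂ (_⊑_ O) refl (natural α (r₁ R) w') l₁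
      , subst₂ (_⊑_ O) (natural α (r₂ R) w') refl l₂

theorem4 : (F G : Functor) (α : NatTrans F G) →
    (∀ (X : Set) → Surjective (η α X)) →
    (O : Order G) →
    {X₁ X₂ : Set} (b₁ : X₁ → F₀ G X₁) (b₂ : X₂ → F₀ G X₂)
    (a₁ : X₁ → F₀ F X₁) (a₂ : X₂ → F₀ F X₂) →
    (∀ x → η α X₁ (a₁ x) ≡ b₁ x) →
    (∀ x → η α X₂ (a₂ x) ≡ b₂ x) →
    (R : Rel X₁ X₂) →
    IsSimulation G O b₁ b₂ R ⇔ IsSimulation F (inducedOrder α O) a₁ a₂ R
theorem4 F G α surj O b₁ b₂ a₁ a₂ e₁ e₂ R = mk⇔
  (simulation⇒induced-simulation α O a₁ a₂ R (surj (Carrier R))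
    ∘ IsSimulation-resp-≗ O (sym ∘ e₁) (sym ∘ e₂) R)
  (IsSimulation-resp-≗ O e₁ e₂ R ∘ induced-simulation⇒simulation α O a₁ a₂ R)
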